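{- Let $V$ be a finite set of variables and $\mathcal{B}$ a family of nonempty proper subsets of $V$. For each of the six measures $*\in\{B,BA,TA,C,BC,L\}$ there exists a $|\cdot|_*$-minimum representation $\Phi$ of $h_{\mathcal{B}}$ whose set of bodies is exactly $\mathcal{B}^\bot$, i.e. $\mathcal{B}_\Phi=\mathcal{B}^\bot$.
   Context: A pure Horn clause $B\rightarrow v$, with $\emptyset\neq B\subseteq V$ and $v\in V\setminus B$, is the clause $v\vee\bigvee_{u\in B}\overline{u}$; $B$ is its body and $v$ its head. For $H\subseteq V\setminus B$, $B\rightarrow H$ abbreviates $\bigwedge_{v\in H}B\rightarrow v$. A pure Horn CNF grouped by bodies is written $\Phi=\bigwedge_{i=1}^{r}B_i\rightarrow H_i$ with distinct bodies $B_i$ and nonempty $H_i$; $\mathcal{B}_\Phi=\{B_1,\dots,B_r\}$. Measures: $|\Phi|_B=r$, $|\Phi|_{BA}=\sum_i|B_i|$, $|\Phi|_{TA}=\sum_i(|B_i|+|H_i|)$, $|\Phi|_C=\sum_i|H_i|$, $|\Phi|_{BC}=\sum_i(|H_i|+1)$, $|\Phi|_L=\sum_i(|B_i|+1)|H_i|$. The key Horn function $h_{\mathcal{B}}$ is the Boolean function represented by $\bigwedge_{B\in\mathcal{B}}B\rightarrow(V\setminus B)$; a representation of $h_{\mathcal{B}}$ is any pure Horn CNF equivalent to it, and a $|\cdot|_*$-minimum representation is one minimizing $|\cdot|_*$. $\mathcal{B}^\bot$ denotes the family of inclusion-minimal members of $\mathcal{B}$. -}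

module Defs where

open import Data.Nat using (ℕ; suc; _+_; _*_; _≤_)
open import Data.Fin using (Fin)
open import Data.Fin.Subset using (Subset; _∈_; _⊆_; _⊂_; ∁; ∣_∣; Nonempty)
open import Data.List using (List; []; _∷_; map)
open import Data.Nat.ListAction using (sum)
open import Data.List.Relation.Unary.All using (All)
open import Data.List.Relation.Unary.Unique.Propositional using (Unique)
open import Data.List.Membership.Propositional using () renaming (_∈_ to _∈ₗ_)
open import Data.Product using (_×_; _,_; proj₁; proj₂; Σ)
open import Relation.Nullary using (¬_)

-- Variables V = Fin n.  A truth assignment is identified with the set of
-- variables it sets to true (a Subset n).

-- A group  B → H  of pure Horn clauses with body B and head set H.
Group : ℕ → Set
Group n = Subset n × Subset n

body : ∀ {n} → Group n → Subset n
body = proj₁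

heads : ∀ {n} → Group n → Subset n
heads = proj₂

CNF : ℕ → Set
CNF n = List (Group n)

bodies : ∀ {n} → CNF n → List (Subset n)
bodies = map body

WellFormedGroup : ∀ {n} → Group n → Set
WellFormedGroup (B , H) = Nonempty B × Nonempty H × H ⊆ ∁ B

IsGroupedHornCNF : ∀ {n} → CNF n → Set
IsGroupedHornCNF Φ = All WellFormedGroup Φ × Unique (bodies Φ)

SatClause : ∀ {n} → Subset n → Fin n → Subset n → Set
SatClause B v x = B ⊆ x → v ∈ x

SatGroup : ∀ {n} → Group n → Subset n → Set
SatGroup (B , H) x = ∀ v → v ∈ H → SatClause B v x

Sat : ∀ {n} → CNF n → Subset n → Set
Sat Φ x = All (λ g → SatGroup g x) Φ

keyCNF : ∀ {n} → List (Subset n) → CNF n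
keyCNF 𝓑 = map (λ B → (B , ∁ B)) 𝓑

IsRepresentation : ∀ {n} → List (Subset n) → CNF n → Set
IsRepresentation 𝓑 Φ =
  IsGroupedHornCNF Φ × (∀ x → (Sat Φ x → Sat (keyCNF 𝓑) x) × (Sat (keyCNF 𝓑) x → Sat Φ x))

data Measure : Set where
  mB mBA mTA mC mBC mL : Measure

measureGroup : ∀ {n} → Measure → Group n → ℕ
measureGroup mB  (B , H) = 1
measureGroup mBA (B , H) = ∣ B ∣
measureGroup mTA (B , H) = ∣ B ∣ + ∣ H ∣
measureGroup mC  (B , H) = ∣ H ∣
measureGroup mBC (B , H) = ∣ H ∣ + 1
measureGroup mL  (B , H) = (∣ B ∣ + 1) * ∣ H ∣

∣_∣[_] : ∀ {n} → CNF n → Measure → ℕ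
∣ Φ ∣[ m ] = sum (map (measureGroup m) Φ)

IsMinRepresentation : ∀ {n} → Measure → List (Subset n) → CNF n → Set
IsMinRepresentation m 𝓑 Φ =
  IsRepresentation 𝓑 Φ × (∀ Ψ → IsRepresentation 𝓑 Ψ → ∣ Φ ∣[ m ] ≤ ∣ Ψ ∣[ m ])

_∈Min_ : ∀ {n} → Subset n → List (Subset n) → Set
B ∈Min 𝓑 = B ∈ₗ 𝓑 × (∀ B′ → B′ ∈ₗ 𝓑 → ¬ (B′ ⊂ B))

BodiesAreMinimal : ∀ {n} → CNF n → List (Subset n) → Set
BodiesAreMinimal Φ 𝓑 = ∀ B → (B ∈ₗ bodies Φ → B ∈Min 𝓑) × (B ∈Min 𝓑 → B ∈ₗ bodies Φ)

module Submission where

open import Defs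
open import Data.Nat using (ℕ)
open import Data.Fin.Subset using (Subset; ∁; Nonempty)
open import Data.List using (List)
open import Data.List.Relation.Unary.All using (All)
open import Data.Product using (Σ; _×_)

open import Data.Bool using (true; false)
import Data.Bool.Properties as BP
open import Data.Empty using (⊥-elim)
import Data.Fin.Properties as FP
open import Data.Fin.Subset using (_⊆_; _⊂_; _∪_; _∩_; ∣_∣)
import Data.Fin.Subset.Properties as SP
open import Data.List using ([]; _∷_; _++_; [_]; map; length; filter; cartesianProductWith; deduplicate)
import Data.List.Extrema.Nat as Extrema
import Data.List.Properties as LP
open import Data.List.Membership.Propositional using (find; lose) renaming (_∈_ to _∈ₗ_)
import Data.List.Membership.Propositional.Properties as MP
import Data.List.Membership.DecPropositional as MD
open import Data.List.Relation.Binary.Permutation.Propositional using (_↭_; ↭-sym; ↭⇒↭ₛ)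
import Data.List.Relation.Binary.Permutation.Propositional.Properties as PermP
import Data.List.Relation.Binary.Permutation.Setoid.Properties as PermS
open import Data.List.Relation.Unary.All using ([]; _∷_)
import Data.List.Relation.Unary.All as All
import Data.List.Relation.Unary.All.Properties as AllP
open import Data.List.Relation.Unary.All.Properties.Core using (¬All⇒Any¬)
open import Data.List.Relation.Unary.Any as Any using (Any; here; there)
open import Data.List.Relation.Unary.Unique.Propositional using (Unique; []; _∷_)
import Data.List.Relation.Unary.Unique.DecPropositional as UniqueDec
import Data.List.Relation.Unary.Unique.DecPropositional.Properties as UniqueDecP
open import Data.Nat using (zero; suc; _+_; _*_; _≤_; _<_; z≤n; s≤s)
open import Data.Nat.Induction using (<-wellFounded)
open import Data.Nat.ListAction.Properties using (sum-↭)
import Data.Nat.Properties as NP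
open import Algebra.Properties.CommutativeSemigroup NP.+-commutativeSemigroup using (x∙yz≈y∙xz)
open import Data.Product using (_,_; proj₁; proj₂; ∃)
open import Data.Sum using (inj₁; inj₂; [_,_]′)
open import Data.Vec using (_∷_; [])
import Data.Vec.Properties as VP
open import Induction.WellFounded using (Acc; acc)
open import Relation.Binary.PropositionalEquality
  using (_≡_; _≢_; refl; sym; trans; cong; subst; setoid; module ≡-Reasoning)
open import Relation.Nullary using (¬_; Dec; yes; no; ¬?)
open import Relation.Nullary.Decidable using (_×-dec_; _→-dec_; decidable-stable; map′)
open import Relation.Unary using (Decidable)

-- Every body D of a representation Ψ of h_𝓑 contains a member of 𝓑, hence a minimal one
-- B ⊆ D, and every B ∈ 𝓑^⊥ with B ≠ V is a body of Ψ: the assignment B falsifies h_𝓑, and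
-- the only clauses of Ψ it can falsify have body B.  A group D → H_D with D ∉ 𝓑^⊥ can thus
-- be dropped once the group of B is extended by H_D ∖ B: the clauses B → H_D ∖ B follow
-- from h_𝓑, and with B ⊆ D they imply D → H_D.  Since |B| ≤ |D|, this never increases any
-- of the six measures, so every representation can be reduced to one with bodies exactly
-- 𝓑^⊥ that is no larger.  Reduced representations have at most |𝓑| groups over finitely
-- many variables, so a measure-minimal one can be found among finitely many candidates,
-- and it is then minimum among all representations.

_≟ₛ_ : ∀ {n} (p q : Subset n) → Dec (p ≡ q)
_≟ₛ_ = VP.≡-dec BP._≟_

∣p∪q∣≤∣p∣+∣q∣ : ∀ {n} (p q : Subset n) → ∣ p ∪ q ∣ ≤ ∣ p ∣ + ∣ q ∣
∣p∪q∣≤∣p∣+∣q∣ [] [] = z≤n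
∣p∪q∣≤∣p∣+∣q∣ (true ∷ p) (true ∷ q) =
  s≤s (NP.≤-trans (∣p∪q∣≤∣p∣+∣q∣ p q) (NP.+-monoʳ-≤ (∣ p ∣) (NP.n≤1+n (∣ q ∣))))
∣p∪q∣≤∣p∣+∣q∣ (true ∷ p) (false ∷ q) = s≤s (∣p∪q∣≤∣p∣+∣q∣ p q)
∣p∪q∣≤∣p∣+∣q∣ (false ∷ p) (true ∷ q) =
  NP.≤-trans (s≤s (∣p∪q∣≤∣p∣+∣q∣ p q)) (NP.≤-reflexive (sym (NP.+-suc (∣ p ∣) (∣ q ∣))))
∣p∪q∣≤∣p∣+∣q∣ (false ∷ p) (false ∷ q) = ∣p∪q∣≤∣p∣+∣q∣ p q

⊆∧⊄⇒⊇ : ∀ {n} {p q : Subset n} → p ⊆ q → ¬ p ⊂ q → q ⊆ p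
⊆∧⊄⇒⊇ {p = p} p⊆q p⊄q {v} v∈q = decidable-stable (v SP.∈? p) (λ v∉p → p⊄q (p⊆q , v , v∈q , v∉p))

_∈Min?_ : ∀ {n} (B : Subset n) 𝓑 → Dec (B ∈Min 𝓑)
B ∈Min? 𝓑 = MD._∈?_ _≟ₛ_ B 𝓑 ×-dec
  map′ (λ none B′ B′∈𝓑 → All.lookup none B′∈𝓑) (λ none → All.tabulate (none _))
       (All.all? (λ B′ → ¬? (B′ SP.⊂? B)) 𝓑)

∈-∃↭ : ∀ {A : Set} {x : A} {ys} → x ∈ₗ ys → ∃ λ rest → ys ↭ x ∷ rest
∈-∃↭ {x = x} x∈ys with MP.∈-∃++ x∈ys
... | pre , post , refl = pre ++ post , PermP.shift x pre post

Unique⇒length≤ : ∀ {A : Set} {xs ys : List A} → Unique xs → All (_∈ₗ ys) xs → length xs ≤ length ys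
Unique⇒length≤ [] [] = z≤n
Unique⇒length≤ {xs = x ∷ xs} {ys} (x∉xs ∷ unique) (x∈ys ∷ xs⊆ys) with ∈-∃↭ x∈ys
... | rest , ys↭x∷rest = subst (suc (length xs) ≤_) (sym (PermP.↭-length ys↭x∷rest))
  (s≤s (Unique⇒length≤ unique (All.zipWith inRest (x∉xs , xs⊆ys))))
  where
  inRest : ∀ {y} → x ≢ y × y ∈ₗ ys → y ∈ₗ rest
  inRest (x≢y , y∈ys) with PermP.∈-resp-↭ ys↭x∷rest y∈ys
  ... | here y≡x = ⊥-elim (x≢y (sym y≡x))
  ... | there y∈rest = y∈rest

subsets : (n : ℕ) → List (Subset n)
subsets zero = [ [] ]
subsets (suc n) = map (true ∷_) (subsets n) ++ map (false ∷_) (subsets n)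

∈-subsets : ∀ {n} (p : Subset n) → p ∈ₗ subsets n
∈-subsets [] = here refl
∈-subsets (true ∷ p) = MP.∈-++⁺ˡ (MP.∈-map⁺ (true ∷_) (∈-subsets p))
∈-subsets {suc n} (false ∷ p) = MP.∈-++⁺ʳ (map (true ∷_) (subsets n)) (MP.∈-map⁺ (false ∷_) (∈-subsets p))

∀-subset? : ∀ {n} {P : Subset n → Set} → Decidable P → Dec (∀ p → P p)
∀-subset? {n} P? = map′ (λ all p → All.lookup all (∈-subsets p)) (λ all → All.tabulate (λ {p} _ → all p))
  (All.all? P? (subsets n))

groups : (n : ℕ) → List (Group n)
groups n = cartesianProductWith _,_ (subsets n) (subsets n)

∈-groups : ∀ {n} (g : Group n) → g ∈ₗ groups n
∈-groups (B , H) = MP.∈-cartesianProductWith⁺ _,_ (∈-subsets B) (∈-subsets H)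

listsUpTo : {A : Set} → ℕ → List A → List (List A)
listsUpTo zero E = [ [] ]
listsUpTo (suc k) E = [] ∷ cartesianProductWith _∷_ E (listsUpTo k E)

∈-listsUpTo : {A : Set} {E xs : List A} (k : ℕ) → length xs ≤ k → All (_∈ₗ E) xs → xs ∈ₗ listsUpTo k E
∈-listsUpTo {xs = []} zero _ _ = here refl
∈-listsUpTo {xs = []} (suc k) _ _ = here refl
∈-listsUpTo {xs = x ∷ xs} (suc k) (s≤s le) (x∈E ∷ xs⊆E) =
  there (MP.∈-cartesianProductWith⁺ _∷_ x∈E (∈-listsUpTo k le xs⊆E))

satGroup? : ∀ {n} (g : Group n) (x : Subset n) → Dec (SatGroup g x)
satGroup? (B , H) x = FP.all? (λ v → v SP.∈? H →-dec (B SP.⊆? x →-dec v SP.∈? x))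

sat? : ∀ {n} (Φ : CNF n) (x : Subset n) → Dec (Sat Φ x)
sat? Φ x = All.all? (λ g → satGroup? g x) Φ

¬SatGroup⇒body⊆ : ∀ {n} {B H x : Subset n} → ¬ SatGroup (B , H) x → B ⊆ x
¬SatGroup⇒body⊆ {B = B} {x = x} ¬sat =
  decidable-stable (B SP.⊆? x) (λ B⊈x → ¬sat (λ _ _ B⊆x → ⊥-elim (B⊈x B⊆x)))

satGroup-∪⁺ : ∀ {n} {C H X x : Subset n} → SatGroup (C , H) x → SatGroup (C , X) x → SatGroup (C , H ∪ X) x
satGroup-∪⁺ {H = H} {X} satH satX v v∈H∪X with SP.x∈p∪q⁻ H X v∈H∪X
... | inj₁ v∈H = satH v v∈H
... | inj₂ v∈X = satX v v∈X

satGroup-∪⁻ : ∀ {n} {C H X x : Subset n} → SatGroup (C , H ∪ X) x → SatGroup (C , H) x × SatGroup (C , X) x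
satGroup-∪⁻ {H = H} {X} sat = (λ v v∈H → sat v (SP.p⊆p∪q X v∈H)) , (λ v v∈X → sat v (SP.q⊆p∪q H X v∈X))

satGroup-absorbed : ∀ {n} {B D HD x : Subset n} → B ⊆ D → SatGroup (B , HD ∩ ∁ B) x → SatGroup (D , HD) x
satGroup-absorbed {B = B} B⊆D sat v v∈HD D⊆x with v SP.∈? B
... | yes v∈B = D⊆x (B⊆D v∈B)
... | no v∉B = sat v (SP.x∈p∩q⁺ (v∈HD , SP.x∉p⇒x∈∁p v∉B)) (SP.⊆-trans B⊆D D⊆x)

bodies-keyCNF : ∀ {n} (𝓑 : List (Subset n)) → bodies (keyCNF 𝓑) ≡ 𝓑
bodies-keyCNF 𝓑 = trans (sym (LP.map-∘ 𝓑)) (LP.map-id 𝓑)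

keyCNF-sat-mono : ∀ {n} {𝓑 𝓑′ : List (Subset n)} {x} → (∀ {B} → B ∈ₗ 𝓑 → B ∈ₗ 𝓑′) →
  Sat (keyCNF 𝓑′) x → Sat (keyCNF 𝓑) x
keyCNF-sat-mono 𝓑⊆𝓑′ sat = AllP.map⁺ (All.tabulate λ B∈𝓑 → All.lookup sat (MP.∈-map⁺ _ (𝓑⊆𝓑′ B∈𝓑)))

wellFormedGroup? : ∀ {n} (g : Group n) → Dec (WellFormedGroup g)
wellFormedGroup? (B , H) = SP.nonempty? B ×-dec SP.nonempty? H ×-dec H SP.⊆? ∁ B

isRepresentation? : ∀ {n} (𝓑 : List (Subset n)) Φ → Dec (IsRepresentation 𝓑 Φ)
isRepresentation? 𝓑 Φ =
  (All.all? wellFormedGroup? Φ ×-dec UniqueDec.unique? _≟ₛ_ (bodies Φ)) ×-dec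
  ∀-subset? (λ x → (sat? Φ x →-dec sat? (keyCNF 𝓑) x) ×-dec (sat? (keyCNF 𝓑) x →-dec sat? Φ x))

isRepresentation-↭ : ∀ {n} {𝓑 : List (Subset n)} {Φ Ψ} → Φ ↭ Ψ → IsRepresentation 𝓑 Φ → IsRepresentation 𝓑 Ψ
isRepresentation-↭ {n} σ ((wf , unique) , equiv) =
  (PermP.All-resp-↭ σ wf , PermS.Unique-resp-↭ (setoid (Subset n)) (↭⇒↭ₛ (PermP.map⁺ body σ)) unique) ,
  λ x → (λ sat → proj₁ (equiv x) (PermP.All-resp-↭ (↭-sym σ) sat)) ,
        (λ sat → PermP.All-resp-↭ σ (proj₂ (equiv x) sat))

record _≼_ {n} (Φ Ψ : CNF n) : Set where
  constructor measurewise
  field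
    measure-≤ : ∀ m → ∣ Φ ∣[ m ] ≤ ∣ Ψ ∣[ m ]

open _≼_

≼-refl : ∀ {n} {Φ : CNF n} → Φ ≼ Φ
≼-refl = measurewise λ _ → NP.≤-refl

≼-trans : ∀ {n} {Φ Ψ Θ : CNF n} → Φ ≼ Ψ → Ψ ≼ Θ → Φ ≼ Θ
≼-trans Φ≼Ψ Ψ≼Θ = measurewise λ m → NP.≤-trans (measure-≤ Φ≼Ψ m) (measure-≤ Ψ≼Θ m)

↭⇒≼ : ∀ {n} {Φ Ψ : CNF n} → Φ ↭ Ψ → Φ ≼ Ψ
↭⇒≼ σ = measurewise λ m → NP.≤-reflexive (sum-↭ (PermP.map⁺ (measureGroup m) σ))

measureGroup-merge : ∀ {n} (m : Measure) {B D H HD X : Subset n} → ∣ B ∣ ≤ ∣ D ∣ → ∣ X ∣ ≤ ∣ HD ∣ →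
  measureGroup m (B , H ∪ X) ≤ measureGroup m (D , HD) + measureGroup m (B , H)
measureGroup-merge m {B} {D} {H} {HD} {X} b≤d x≤hd = merge m
  where
  open NP.≤-Reasoning
  b d h hd x u : ℕ
  b = ∣ B ∣
  d = ∣ D ∣
  h = ∣ H ∣
  hd = ∣ HD ∣
  x = ∣ X ∣
  u = ∣ H ∪ X ∣
  u≤hd+h : u ≤ hd + h
  u≤hd+h = begin
    u      ≤⟨ ∣p∪q∣≤∣p∣+∣q∣ H X ⟩
    h + x  ≤⟨ NP.+-monoʳ-≤ h x≤hd ⟩
    h + hd ≡⟨ NP.+-comm h hd ⟩
    hd + h ∎
  merge : ∀ m → measureGroup m (B , H ∪ X) ≤ measureGroup m (D , HD) + measureGroup m (B , H)
  merge mB = s≤s z≤n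
  merge mBA = NP.m≤n+m b d
  merge mTA = begin
    b + u              ≤⟨ NP.+-monoʳ-≤ b u≤hd+h ⟩
    b + (hd + h)       ≡⟨ x∙yz≈y∙xz b hd h ⟩
    hd + (b + h)       ≤⟨ NP.+-monoˡ-≤ (b + h) (NP.m≤n+m hd d) ⟩
    d + hd + (b + h)   ∎
  merge mC = u≤hd+h
  merge mBC = begin
    u + 1              ≤⟨ NP.+-monoˡ-≤ 1 u≤hd+h ⟩
    hd + h + 1         ≡⟨ NP.+-assoc hd h 1 ⟩
    hd + (h + 1)       ≤⟨ NP.+-monoˡ-≤ (h + 1) (NP.m≤m+n hd 1) ⟩
    hd + 1 + (h + 1)   ∎
  merge mL = begin
    (b + 1) * u                    ≤⟨ NP.*-monoʳ-≤ (b + 1) u≤hd+h ⟩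
    (b + 1) * (hd + h)             ≡⟨ NP.*-distribˡ-+ (b + 1) hd h ⟩
    (b + 1) * hd + (b + 1) * h     ≤⟨ NP.+-monoˡ-≤ ((b + 1) * h) (NP.*-monoˡ-≤ hd (NP.+-monoˡ-≤ 1 b≤d)) ⟩
    (d + 1) * hd + (b + 1) * h     ∎

absorb : ∀ {n} → Subset n → Subset n → CNF n → CNF n
absorb B X [] = []
absorb B X ((C , H) ∷ Φ) with C ≟ₛ B
... | yes _ = (C , H ∪ X) ∷ Φ
... | no _ = (C , H) ∷ absorb B X Φ

bodies-absorb : ∀ {n} (B X : Subset n) Φ → bodies (absorb B X Φ) ≡ bodies Φ
bodies-absorb B X [] = refl
bodies-absorb B X ((C , H) ∷ Φ) with C ≟ₛ B
... | yes _ = refl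
... | no _ = cong (C ∷_) (bodies-absorb B X Φ)

length-absorb : ∀ {n} (B X : Subset n) Φ → length (absorb B X Φ) ≡ length Φ
length-absorb B X Φ = begin
  length (absorb B X Φ)          ≡⟨ LP.length-map body (absorb B X Φ) ⟨
  length (bodies (absorb B X Φ)) ≡⟨ cong length (bodies-absorb B X Φ) ⟩
  length (bodies Φ)              ≡⟨ LP.length-map body Φ ⟩
  length Φ                       ∎
  where open ≡-Reasoning

sat-absorb⁺ : ∀ {n} {B X x : Subset n} Φ → Sat Φ x → SatGroup (B , X) x → Sat (absorb B X Φ) x
sat-absorb⁺ [] [] _ = []
sat-absorb⁺ {B = B} ((C , H) ∷ Φ) (satC ∷ satΦ) satB with C ≟ₛ B
... | yes refl = satGroup-∪⁺ satC satB ∷ satΦ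
... | no _ = satC ∷ sat-absorb⁺ Φ satΦ satB

sat-absorb⁻ : ∀ {n} {B X x : Subset n} Φ → B ∈ₗ bodies Φ → Sat (absorb B X Φ) x → Sat Φ x × SatGroup (B , X) x
sat-absorb⁻ {B = B} ((C , H) ∷ Φ) B∈ sat with C ≟ₛ B | sat
... | yes refl | satC∪ ∷ satΦ = let satC , satB = satGroup-∪⁻ satC∪ in satC ∷ satΦ , satB
... | no C≢B | satC ∷ satAbsorb with B∈
...   | here B≡C = ⊥-elim (C≢B (sym B≡C))
...   | there B∈Φ = let satΦ , satB = sat-absorb⁻ Φ B∈Φ satAbsorb in satC ∷ satΦ , satB

wellFormed-absorb : ∀ {n} {B X : Subset n} Φ → X ⊆ ∁ B → All WellFormedGroup Φ → All WellFormedGroup (absorb B X Φ)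
wellFormed-absorb [] _ [] = []
wellFormed-absorb {B = B} {X} ((C , H) ∷ Φ) X⊆∁B (wf ∷ wfs) with C ≟ₛ B | wf
... | yes refl | C≠∅ , (v , v∈H) , H⊆∁C =
  (C≠∅ , (v , SP.p⊆p∪q X v∈H) , λ v∈H∪X → [ H⊆∁C , X⊆∁B ]′ (SP.x∈p∪q⁻ H X v∈H∪X)) ∷ wfs
... | no _ | _ = wf ∷ wellFormed-absorb Φ X⊆∁B wfs

measure-absorb : ∀ {n} (m : Measure) {B X : Subset n} (k : ℕ) Φ →
  (∀ H → measureGroup m (B , H ∪ X) ≤ k + measureGroup m (B , H)) → ∣ absorb B X Φ ∣[ m ] ≤ k + ∣ Φ ∣[ m ]
measure-absorb m k [] _ = z≤n
measure-absorb m {B} k ((C , H) ∷ Φ) growth with C ≟ₛ B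
... | yes refl = NP.≤-trans (NP.+-monoˡ-≤ ∣ Φ ∣[ m ] (growth H)) (NP.≤-reflexive (NP.+-assoc k _ _))
... | no _ = NP.≤-trans (NP.+-monoʳ-≤ (measureGroup m (C , H)) (measure-absorb m k Φ growth))
                       (NP.≤-reflexive (x∙yz≈y∙xz (measureGroup m (C , H)) k ∣ Φ ∣[ m ]))

module _ {n : ℕ} (𝓑 : List (Subset n)) where

  satGroup-keyCNF : ∀ {B H x} → Sat (keyCNF 𝓑) x → B ∈ₗ 𝓑 → H ⊆ ∁ B → SatGroup (B , H) x
  satGroup-keyCNF sat B∈𝓑 H⊆∁B v v∈H = All.lookup sat (MP.∈-map⁺ (λ B → B , ∁ B) B∈𝓑) v (H⊆∁B v∈H)

  keyCNF-sat-vacuous : ∀ {x} → ¬ Any (_⊆ x) 𝓑 → Sat (keyCNF 𝓑) x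
  keyCNF-sat-vacuous none = AllP.map⁺ (All.tabulate (λ B∈𝓑 _ _ B⊆x → ⊥-elim (none (lose B∈𝓑 B⊆x))))

  ¬sat-keyCNF-member : ∀ {B} → B ∈ₗ 𝓑 → Nonempty (∁ B) → ¬ Sat (keyCNF 𝓑) B
  ¬sat-keyCNF-member B∈𝓑 (w , w∈∁B) sat =
    SP.x∈∁p⇒x∉p w∈∁B (satGroup-keyCNF sat B∈𝓑 SP.⊆-refl w w∈∁B SP.⊆-refl)

  keyCNF-deduplicate-isRepresentation : All (λ B → Nonempty B × Nonempty (∁ B)) 𝓑 →
    IsRepresentation 𝓑 (keyCNF (deduplicate _≟ₛ_ 𝓑))
  keyCNF-deduplicate-isRepresentation proper = (wf , unique) ,
    λ x → keyCNF-sat-mono (MP.∈-deduplicate⁺ _≟ₛ_) , keyCNF-sat-mono (MP.∈-deduplicate⁻ _≟ₛ_ 𝓑)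
    where
    wf : All WellFormedGroup (keyCNF (deduplicate _≟ₛ_ 𝓑))
    wf = AllP.map⁺ (All.tabulate λ B∈ →
      let B≠∅ , ∁B≠∅ = All.lookup proper (MP.∈-deduplicate⁻ _≟ₛ_ 𝓑 B∈) in B≠∅ , ∁B≠∅ , SP.⊆-refl)
    unique : Unique (bodies (keyCNF (deduplicate _≟ₛ_ 𝓑)))
    unique = subst Unique (sym (bodies-keyCNF _)) (UniqueDecP.deduplicate-! _≟ₛ_ 𝓑)

  member⊆body : ∀ {Ψ} → IsRepresentation 𝓑 Ψ → ∀ {D H} → (D , H) ∈ₗ Ψ → ∃ λ C → C ∈ₗ 𝓑 × C ⊆ D
  member⊆body ((wf , _) , equiv) {D} g∈Ψ with All.lookup wf g∈Ψ
  ... | _ , (v , v∈H) , H⊆∁D = find (decidable-stable (Any.any? (SP._⊆? D) 𝓑) ¬¬below)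
    where
    ¬¬below : ¬ ¬ Any (_⊆ D) 𝓑
    ¬¬below none =
      SP.x∈∁p⇒x∉p (H⊆∁D v∈H) (All.lookup (proj₂ (equiv D) (keyCNF-sat-vacuous none)) g∈Ψ v v∈H SP.⊆-refl)

  -- A member of least cardinality among those below C is inclusion-minimal.
  minimal⊆member : ∀ {C} → C ∈ₗ 𝓑 → ∃ λ B → B ∈Min 𝓑 × B ⊆ C
  minimal⊆member {C} C∈𝓑 = B , (proj₁ B∈𝓑×B⊆C , minimal) , proj₂ B∈𝓑×B⊆C
    where
    below = filter (SP._⊆? C) 𝓑
    B = Extrema.argmin ∣_∣ C below
    B∈𝓑×B⊆C : B ∈ₗ 𝓑 × B ⊆ C
    B∈𝓑×B⊆C = Extrema.argmin-all ∣_∣ {P = λ B → B ∈ₗ 𝓑 × B ⊆ C} (C∈𝓑 , SP.⊆-refl)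
      (All.tabulate (MP.∈-filter⁻ (SP._⊆? C)))
    minimal : ∀ B′ → B′ ∈ₗ 𝓑 → ¬ B′ ⊂ B
    minimal B′ B′∈𝓑 B′⊂B = NP.<⇒≱ (SP.p⊂q⇒∣p∣<∣q∣ B′⊂B)
      (All.lookup (Extrema.f[argmin]≤f[xs] C below)
        (MP.∈-filter⁺ (SP._⊆? C) B′∈𝓑 (SP.⊆-trans (SP.p⊂q⇒p⊆q B′⊂B) (proj₂ B∈𝓑×B⊆C))))

  minimal∈bodies : ∀ {Ψ} → IsRepresentation 𝓑 Ψ → ∀ {B} → B ∈Min 𝓑 → Nonempty (∁ B) → B ∈ₗ bodies Ψ
  minimal∈bodies {Ψ} rep@(_ , equiv) {B} (B∈𝓑 , minimal) ∁B≠∅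
    with find (¬All⇒Any¬ (λ g → satGroup? g B) Ψ (λ sat → ¬sat-keyCNF-member B∈𝓑 ∁B≠∅ (proj₁ (equiv B) sat)))
  ... | (D , H) , g∈Ψ , ¬satD with member⊆body rep g∈Ψ
  ... | C , C∈𝓑 , C⊆D = subst (_∈ₗ bodies Ψ) D≡B (MP.∈-map⁺ body g∈Ψ)
    where
    D⊆B : D ⊆ B
    D⊆B = ¬SatGroup⇒body⊆ ¬satD
    D≡B : D ≡ B
    D≡B = SP.⊆-antisym D⊆B (SP.⊆-trans (⊆∧⊄⇒⊇ (SP.⊆-trans C⊆D D⊆B) (minimal C C∈𝓑)) C⊆D)

  absorb-representation : ∀ {B D HD R} → IsRepresentation 𝓑 ((D , HD) ∷ R) → B ∈ₗ 𝓑 → B ⊆ D → B ∈ₗ bodies R →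
    IsRepresentation 𝓑 (absorb B (HD ∩ ∁ B) R)
  absorb-representation {B} {D} {HD} {R} ((_ ∷ wf , _ ∷ unique) , equiv) B∈𝓑 B⊆D B∈R =
    (wellFormed-absorb R X⊆∁B wf , subst Unique (sym (bodies-absorb B X R)) unique) , λ x → to x , from x
    where
    X = HD ∩ ∁ B
    X⊆∁B : X ⊆ ∁ B
    X⊆∁B v∈X = proj₂ (SP.x∈p∩q⁻ HD (∁ B) v∈X)
    to : ∀ x → Sat (absorb B X R) x → Sat (keyCNF 𝓑) x
    to x sat = let satR , satB = sat-absorb⁻ R B∈R sat in
      proj₁ (equiv x) (satGroup-absorbed B⊆D satB ∷ satR)
    from : ∀ x → Sat (keyCNF 𝓑) x → Sat (absorb B X R) x
    from x sat with proj₂ (equiv x) sat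
    ... | _ ∷ satR = sat-absorb⁺ R satR (satGroup-keyCNF sat B∈𝓑 X⊆∁B)

  absorb-≼ : ∀ {B D : Subset n} HD R → B ⊆ D → absorb B (HD ∩ ∁ B) R ≼ ((D , HD) ∷ R)
  absorb-≼ {B} {D} HD R B⊆D = measurewise λ m → measure-absorb m (measureGroup m (D , HD)) R λ _ →
    measureGroup-merge m (SP.p⊆q⇒∣p∣≤∣q∣ B⊆D) (SP.∣p∩q∣≤∣p∣ HD (∁ B))

  IsReduced : CNF n → Set
  IsReduced Φ = IsRepresentation 𝓑 Φ × All (_∈Min 𝓑) (bodies Φ)

  isReduced? : ∀ Φ → Dec (IsReduced Φ)
  isReduced? Φ = isRepresentation? 𝓑 Φ ×-dec All.all? (_∈Min? 𝓑) (bodies Φ)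

  shortCNFs : List (CNF n)
  shortCNFs = listsUpTo (length 𝓑) (groups n)

  reducedCandidates : List (CNF n)
  reducedCandidates = filter isReduced? shortCNFs

  reduced∈candidates : ∀ {Φ} → IsReduced Φ → Φ ∈ₗ reducedCandidates
  reduced∈candidates {Φ} reduced@(((_ , unique) , _) , minimal) =
    MP.∈-filter⁺ isReduced? (∈-listsUpTo (length 𝓑) fewGroups (All.tabulate λ {g} _ → ∈-groups g)) reduced
    where
    fewGroups : length Φ ≤ length 𝓑
    fewGroups = subst (_≤ length 𝓑) (LP.length-map body Φ) (Unique⇒length≤ unique (All.map proj₁ minimal))

  minimumReduced : (m : Measure) → ∀ Φ₀ → IsReduced Φ₀ →
    Σ (CNF n) λ Φ → IsReduced Φ × (∀ Ψ → IsReduced Ψ → ∣ Φ ∣[ m ] ≤ ∣ Ψ ∣[ m ])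
  minimumReduced m Φ₀ reduced₀ =
    Extrema.argmin ∣_∣[ m ] Φ₀ reducedCandidates ,
    Extrema.argmin-all ∣_∣[ m ] reduced₀ (AllP.all-filter isReduced? shortCNFs) ,
    λ Ψ reduced → All.lookup (Extrema.f[argmin]≤f[xs] Φ₀ reducedCandidates) (reduced∈candidates reduced)

  module Reduction (proper : All (λ B → Nonempty B × Nonempty (∁ B)) 𝓑) where

    merge-nonminimal : ∀ {D HD R} → IsRepresentation 𝓑 ((D , HD) ∷ R) → ¬ D ∈Min 𝓑 →
      Σ (CNF n) λ Ψ → IsRepresentation 𝓑 Ψ × Ψ ≼ ((D , HD) ∷ R) × length Ψ < suc (length R)
    merge-nonminimal {D} {HD} {R} rep D∉Min with member⊆body rep (here refl)
    ... | C , C∈𝓑 , C⊆D with minimal⊆member C∈𝓑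
    ... | B , B∈Min , B⊆C =
      absorb B (HD ∩ ∁ B) R ,
      absorb-representation rep (proj₁ B∈Min) B⊆D B∈R ,
      absorb-≼ HD R B⊆D ,
      s≤s (NP.≤-reflexive (length-absorb B (HD ∩ ∁ B) R))
      where
      B⊆D : B ⊆ D
      B⊆D = SP.⊆-trans B⊆C C⊆D
      B∈R : B ∈ₗ bodies R
      B∈R with minimal∈bodies rep B∈Min (proj₂ (All.lookup proper (proj₁ B∈Min)))
      ... | here B≡D = ⊥-elim (D∉Min (subst (_∈Min 𝓑) B≡D B∈Min))
      ... | there B∈R = B∈R

    reduce-acc : ∀ Ψ → Acc _<_ (length Ψ) → IsRepresentation 𝓑 Ψ → Σ (CNF n) λ Φ → IsReduced Φ × Φ ≼ Ψ
    reduce-acc Ψ (acc smaller) rep with All.all? (λ g → body g ∈Min? 𝓑) Ψ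
    ... | yes allMinimal = Ψ , (rep , AllP.map⁺ allMinimal) , ≼-refl
    ... | no ¬allMinimal =
      let g , g∈Ψ , ¬minimal = find (¬All⇒Any¬ (λ g → body g ∈Min? 𝓑) Ψ ¬allMinimal)
          R , σ = ∈-∃↭ g∈Ψ
          Ψ′ , rep′ , Ψ′≼ , shorter = merge-nonminimal (isRepresentation-↭ σ rep) ¬minimal
          Φ , reduced , Φ≼Ψ′ = reduce-acc Ψ′ (smaller (subst (length Ψ′ <_) (sym (PermP.↭-length σ)) shorter)) rep′
      in Φ , reduced , ≼-trans Φ≼Ψ′ (≼-trans Ψ′≼ (↭⇒≼ (↭-sym σ)))

    reduce : ∀ {Ψ} → IsRepresentation 𝓑 Ψ → Σ (CNF n) λ Φ → IsReduced Φ × Φ ≼ Ψ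
    reduce {Ψ} = reduce-acc Ψ (<-wellFounded (length Ψ))

    minimumRepresentation : (m : Measure) →
      Σ (CNF n) λ Φ → IsReduced Φ × (∀ Ψ → IsRepresentation 𝓑 Ψ → ∣ Φ ∣[ m ] ≤ ∣ Ψ ∣[ m ])
    minimumRepresentation m with reduce (keyCNF-deduplicate-isRepresentation proper)
    ... | Φ₀ , reduced₀ , _ with minimumReduced m Φ₀ reduced₀
    ... | Φ , reduced , least = Φ , reduced , λ Ψ rep →
      let Ψ′ , reducedΨ′ , Ψ′≼Ψ = reduce rep in NP.≤-trans (least Ψ′ reducedΨ′) (measure-≤ Ψ′≼Ψ m)

lemma1 : (n : ℕ) (𝓑 : List (Subset n)) →
    All (λ B → Nonempty B × Nonempty (∁ B)) 𝓑 →
    (m : Measure) →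
    Σ (CNF n) (λ Φ → IsMinRepresentation m 𝓑 Φ × BodiesAreMinimal Φ 𝓑)
lemma1 n 𝓑 proper m with Reduction.minimumRepresentation 𝓑 proper m
... | Φ , (representation , minimalBodies) , minimum =
  Φ , (representation , minimum) ,
  λ B → All.lookup minimalBodies ,
        λ B∈Min → minimal∈bodies 𝓑 representation B∈Min (proj₂ (All.lookup proper (proj₁ B∈Min)))
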